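{- Let $p$ be a prime. Let $a,b$ be integers with $1\le b\le a$, $\nu(a-b)=0$, and $\{\nu(a),\nu(b)\}=\{0,k\}$ for some integer $k\ge 0$. Let $c=a$ if $\nu(a)=k$ and $c=b$ if $\nu(b)=k$. Then for every positive integer $e$, $$\mathrm{u}\binom{ap^e}{bp^e}\equiv(-1)^{pck}\,\frac{z_a}{z_b\,z_{a-b}}\pmod{p^e}$$ (congruence in $\mathbb{Z}_p$).
   Context: For a prime $p$ and a positive integer $n$, $\nu(n)$ denotes the exponent of $p$ in $n$ and $\mathrm{u}(n)=n/p^{\nu(n)}$ its unit part. For a positive integer $\alpha$ not divisible by $p$, $z_\alpha\in\mathbb{Z}_p$ denotes the $p$-adic limit $\lim_{e\to\infty}(-1)^{p\alpha e}\mathrm{u}((\alpha p^e)!)$ (which exists and is a $p$-adic unit). For an arbitrary positive integer $n$, $z_n:=z_{\mathrm{u}(n)}$. -}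

module Defs where

open import Data.Nat using (ℕ; zero; suc; _*_; _^_; _≤_; _!)
open import Data.Nat.Divisibility using (_∣?_; _∣_)
open import Data.Integer as ℤ using (ℤ; +_; -_)
import Data.Integer.Divisibility as ℤD
open import Data.Product using (∃)
open import Relation.Nullary using (yes; no)

-- p-adic valuation ν_p(n) for n ≥ 1 (fuel-based; fuel n suffices for p ≥ 2).
-- Convention ν_p(0) = 0 here (irrelevant: only used on positive arguments).
νf : ℕ → ℕ → ℕ → ℕ
νf zero p n = 0
νf (suc f) p zero = 0
νf (suc f) p (suc m) with p ∣? suc m
... | yes d = suc (νf f p (_∣_.quotient d))
... | no _  = 0

ν : ℕ → ℕ → ℕ
ν p n = νf n p n

uf : ℕ → ℕ → ℕ → ℕ
uf zero p n = n
uf (suc f) p zero = zero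
uf (suc f) p (suc m) with p ∣? suc m
... | yes d = uf f p (_∣_.quotient d)
... | no _  = suc m

u : ℕ → ℕ → ℕ
u p n = uf n p n

-- p-adic integers as coherent sequences of approximations: seq m is x mod p^m.
record ℤp (p : ℕ) : Set where
  field
    seq : ℕ → ℤ
    coh : ∀ m n → m ≤ n → (+ (p ^ m)) ℤD.∣ (seq n ℤ.- seq m)
open ℤp public

zseq : ℕ → ℕ → ℕ → ℤ
zseq p α E = ((- (+ 1)) ℤ.^ (p * α * E)) ℤ.* (+ u p ((α * p ^ E) !))

IsLimit : (p : ℕ) → (ℕ → ℤ) → ℤp p → Set
IsLimit p s x = ∀ m → ∃ λ E₀ → ∀ E → E₀ ≤ E → (+ (p ^ m)) ℤD.∣ (s E ℤ.- seq x m)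

-- x = z_n := z_{u(n)} = lim_E (-1)^{p u(n) E} u((u(n) p^E)!)
IsZ : (p n : ℕ) → ℤp p → Set
IsZ p n x = IsLimit p (zseq p (u p n)) x

-- Split n! = F(n) · H(n), where F(n) multiplies the integers ≤ n prime to p and H(n) the
-- multiples of p. Then H(Np) = p^N · N!, so u((Np)!) = F(Np) · u(N!). Modulo P = p^e the
-- function F is multiplicative along multiples of P, hence F(qP) ≡ F(P)^q, and iterating gives
-- u((M p^(e+d))!) ≡ u((M p^e)!) · F(P)^(M s) with s independent of M. This correction factor
-- is exponential in M, so it cancels when the identity u(C(aP,bP)) · u((bP)!) · u(((a-b)P)!) =
-- u((aP)!) is lifted to level E = e + d. For E large, u((n p^E)!) approximates z_n up to the
-- sign (-1)^(p n (E + ν(n))), because u(n) p^(E+ν(n)) = n p^E and p u(n) ≡ p n modulo 2; the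
-- hypotheses on the valuations make these signs combine to (-1)^(pck).

module Submission where

open import Defs
open import Data.Nat using (ℕ; _*_; _^_; _≤_; _<_; _∸_)
open import Data.Nat.Primality using (Prime)
open import Data.Nat.Combinatorics using (_C_)
open import Data.Integer as ℤ using (ℤ; +_; -_)
import Data.Integer.Divisibility as ℤD
open import Data.Product using (_×_)
open import Data.Sum using (_⊎_)
open import Relation.Binary.PropositionalEquality using (_≡_)

open import Data.Nat as ℕ using (zero; suc; pred; _+_; _!; _⊔_; NonZero; s≤s; z≤n)
import Data.Nat.Properties as ℕP
open import Data.Nat.Divisibility using (_∣_; _∤_; divides; _∣?_; ∣⇒≤; m∣m*n; n∣m*n; ∣-trans; ∣m∣n⇒∣m+n; ∣m+n∣m⇒∣n)
open import Data.Nat.Primality using (prime⇒nonZero; prime⇒nonTrivial; euclidsLemma)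
open import Data.Nat.Combinatorics using (nCk≡n!/k![n-k]!; k![n∸k]!∣n!)
open import Data.Nat.DivMod using (m/n*n≡m)
import Data.Integer.Properties as ℤP
import Data.Integer.Divisibility.Signed as ℤDS
open import Level using (0ℓ)
open import Relation.Binary.Bundles using (Setoid)
open import Relation.Binary.Structures using (IsEquivalence)
import Relation.Binary.Construct.On as On
open import Data.Integer.Tactic.RingSolver using (solve-∀)
import Data.Nat.Tactic.RingSolver as ℕSolver
open import Data.Product using (_,_; proj₁; proj₂; ∃-syntax)
open import Data.Sum using (inj₁; inj₂)
open import Relation.Nullary using (yes; no; contradiction)
open import Relation.Binary.PropositionalEquality using (refl; sym; trans; cong; cong₂; subst; subst₂; module ≡-Reasoning)

-1^_ : ℕ → ℤ
-1^ n = (- (+ 1)) ℤ.^ n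

-1^-+ : ∀ m n → -1^ (m + n) ≡ -1^ m ℤ.* -1^ n
-1^-+ = ℤP.^-distribˡ-+-* (- (+ 1))

-1^n*-1^n≡1 : ∀ n → -1^ n ℤ.* -1^ n ≡ + 1
-1^n*-1^n≡1 zero    = refl
-1^n*-1^n≡1 (suc n) = trans (square-of-neg (-1^ n)) (-1^n*-1^n≡1 n)
  where
  square-of-neg : ∀ x → (- (+ 1)) ℤ.* x ℤ.* ((- (+ 1)) ℤ.* x) ≡ x ℤ.* x
  square-of-neg = solve-∀

-1^[m*0]≡1 : ∀ m → -1^ (m * 0) ≡ + 1
-1^[m*0]≡1 m = cong -1^_ (ℕP.*-zeroʳ m)

-1^n≡±1 : ∀ n → -1^ n ≡ + 1 ⊎ -1^ n ≡ - (+ 1)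
-1^n≡±1 zero = inj₁ refl
-1^n≡±1 (suc n) with -1^n≡±1 n
... | inj₁ ≡1  = inj₂ (cong ((- (+ 1)) ℤ.*_) ≡1)
... | inj₂ ≡-1 = inj₁ (cong ((- (+ 1)) ℤ.*_) ≡-1)

-- m * m ≡ m (mod 2).
-1^[m*[m*n]]≡-1^[m*n] : ∀ m n → -1^ (m * (m * n)) ≡ -1^ (m * n)
-1^[m*[m*n]]≡-1^[m*n] m n with -1^n≡±1 m
... | inj₂ ≡-1 = trans (sym (ℤP.^-*-assoc (- (+ 1)) m (m * n))) (cong (ℤ._^ (m * n)) ≡-1)
... | inj₁ ≡1  = begin
  -1^ (m * (m * n))      ≡⟨ ℤP.^-*-assoc (- (+ 1)) m (m * n) ⟨
  (-1^ m) ℤ.^ (m * n)    ≡⟨ cong (ℤ._^ (m * n)) ≡1 ⟩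
  (+ 1) ℤ.^ (m * n)      ≡⟨ ℤP.^-zeroˡ (m * n) ⟩
  + 1                    ≡⟨ ℤP.^-zeroˡ n ⟨
  (+ 1) ℤ.^ n            ≡⟨ cong (ℤ._^ n) ≡1 ⟨
  (-1^ m) ℤ.^ n          ≡⟨ ℤP.^-*-assoc (- (+ 1)) m n ⟩
  -1^ (m * n)            ∎
  where open ≡-Reasoning

-1^[m*[k*m^j]*x]≡-1^[m*k*x] : ∀ m k j x → -1^ (m * (k * m ^ j) * x) ≡ -1^ (m * k * x)
-1^[m*[k*m^j]*x]≡-1^[m*k*x] m k zero x = cong (λ n → -1^ (m * n * x)) (ℕP.*-identityʳ k)
-1^[m*[k*m^j]*x]≡-1^[m*k*x] m k (suc j) x = begin
  -1^ (m * (k * m ^ suc j) * x)   ≡⟨ cong -1^_ (extract-m m k (m ^ j) x) ⟩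
  -1^ (m * (m * (k * m ^ j * x))) ≡⟨ -1^[m*[m*n]]≡-1^[m*n] m (k * m ^ j * x) ⟩
  -1^ (m * (k * m ^ j * x))       ≡⟨ cong -1^_ (ℕP.*-assoc m (k * m ^ j) x) ⟨
  -1^ (m * (k * m ^ j) * x)       ≡⟨ -1^[m*[k*m^j]*x]≡-1^[m*k*x] m k j x ⟩
  -1^ (m * k * x)                 ∎
  where
  open ≡-Reasoning
  extract-m : ∀ m k q x → m * (k * (m * q)) * x ≡ m * (m * (k * q * x))
  extract-m = ℕSolver.solve-∀

-1^-valuations : ∀ m {a b c k i j} → (i ≡ 0 × j ≡ k ⊎ i ≡ k × j ≡ 0) →
  (i ≡ k × c ≡ a ⊎ j ≡ k × c ≡ b) → -1^ (m * a * i) ℤ.* -1^ (m * b * j) ≡ -1^ (m * c * k)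
-1^-valuations m {a} {b} (inj₁ (refl , refl)) (inj₁ (refl , refl))
  rewrite -1^[m*0]≡1 (m * a) | -1^[m*0]≡1 (m * b) = refl
-1^-valuations m {a} {b} (inj₁ (refl , refl)) (inj₂ (_ , refl))
  rewrite -1^[m*0]≡1 (m * a) = ℤP.*-identityˡ _
-1^-valuations m {a} {b} (inj₂ (refl , refl)) (inj₁ (_ , refl))
  rewrite -1^[m*0]≡1 (m * b) = ℤP.*-identityʳ _
-1^-valuations m {a} {b} (inj₂ (refl , refl)) (inj₂ (refl , refl))
  rewrite -1^[m*0]≡1 (m * a) | -1^[m*0]≡1 (m * b) = refl

-1^-balance : ∀ m {a b c k i j l} E → b ≤ a → l ≡ 0 →
  (i ≡ 0 × j ≡ k ⊎ i ≡ k × j ≡ 0) → (i ≡ k × c ≡ a ⊎ j ≡ k × c ≡ b) →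
  -1^ (m * b * (E + j)) ℤ.* -1^ (m * (a ∸ b) * (E + l)) ≡ -1^ (m * c * k) ℤ.* -1^ (m * a * (E + i))
-1^-balance m {a} {b} {c} {k} {i} {j} E b≤a refl valuations choice = begin
  -1^ (m * b * (E + j)) ℤ.* -1^ (m * (a ∸ b) * (E + 0))
    ≡⟨ cong₂ ℤ._*_ (split b j) (cong (λ n → -1^ (m * (a ∸ b) * n)) (ℕP.+-identityʳ E)) ⟩
  -1^ (m * b * E) ℤ.* -1^ (m * b * j) ℤ.* -1^ (m * (a ∸ b) * E)
    ≡⟨ xy*z≡y*xz (-1^ (m * b * E)) (-1^ (m * b * j)) (-1^ (m * (a ∸ b) * E)) ⟩
  -1^ (m * b * j) ℤ.* (-1^ (m * b * E) ℤ.* -1^ (m * (a ∸ b) * E))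
    ≡⟨ cong (-1^ (m * b * j) ℤ.*_) linear ⟩
  -1^ (m * b * j) ℤ.* -1^ (m * a * E)
    ≡⟨ ℤP.*-identityˡ _ ⟨
  + 1 ℤ.* (-1^ (m * b * j) ℤ.* -1^ (m * a * E))
    ≡⟨ cong (ℤ._* _) (-1^n*-1^n≡1 (m * a * i)) ⟨
  -1^ (m * a * i) ℤ.* -1^ (m * a * i) ℤ.* (-1^ (m * b * j) ℤ.* -1^ (m * a * E))
    ≡⟨ regroup (-1^ (m * a * i)) (-1^ (m * b * j)) (-1^ (m * a * E)) ⟩
  -1^ (m * a * i) ℤ.* -1^ (m * b * j) ℤ.* (-1^ (m * a * E) ℤ.* -1^ (m * a * i))
    ≡⟨ cong₂ ℤ._*_ (-1^-valuations m valuations choice) (sym (split a i)) ⟩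
  -1^ (m * c * k) ℤ.* -1^ (m * a * (E + i)) ∎
  where
  open ≡-Reasoning
  split : ∀ n v → -1^ (m * n * (E + v)) ≡ -1^ (m * n * E) ℤ.* -1^ (m * n * v)
  split n v = trans (cong -1^_ (ℕP.*-distribˡ-+ (m * n) E v)) (-1^-+ (m * n * E) (m * n * v))
  linear : -1^ (m * b * E) ℤ.* -1^ (m * (a ∸ b) * E) ≡ -1^ (m * a * E)
  linear = begin
    -1^ (m * b * E) ℤ.* -1^ (m * (a ∸ b) * E) ≡⟨ -1^-+ (m * b * E) (m * (a ∸ b) * E) ⟨
    -1^ (m * b * E + m * (a ∸ b) * E)          ≡⟨ cong -1^_ (distrib m b (a ∸ b) E) ⟩
    -1^ (m * (b + (a ∸ b)) * E)                ≡⟨ cong (λ n → -1^ (m * n * E)) (ℕP.m+[n∸m]≡n b≤a) ⟩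
    -1^ (m * a * E)                            ∎
    where
    distrib : ∀ m x y E → m * x * E + m * y * E ≡ m * (x + y) * E
    distrib = ℕSolver.solve-∀
  xy*z≡y*xz : ∀ x y z → x ℤ.* y ℤ.* z ≡ y ℤ.* (x ℤ.* z)
  xy*z≡y*xz = solve-∀
  regroup : ∀ d b g → d ℤ.* d ℤ.* (b ℤ.* g) ≡ d ℤ.* b ℤ.* (g ℤ.* d)
  regroup = solve-∀

module UnitPart {p : ℕ} (pr : Prime p) where

  open ℕP

  private
    instance
      p≢0 : NonZero p
      p≢0 = prime⇒nonZero pr

    1<p : 1 < p
    1<p = ℕ.nonTrivial⇒n>1 p {{prime⇒nonTrivial pr}}

  p∤1 : p ∤ 1
  p∤1 p∣1 = <⇒≱ 1<p (∣⇒≤ p∣1)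

  p∤m⇒1≤m : ∀ {m} → p ∤ m → 1 ≤ m
  p∤m⇒1≤m {zero}  p∤0 = contradiction (divides 0 refl) p∤0
  p∤m⇒1≤m {suc m} _   = s≤s z≤n

  p∤m⇒p∤n⇒p∤m*n : ∀ {m n} → p ∤ m → p ∤ n → p ∤ m * n
  p∤m⇒p∤n⇒p∤m*n {m} {n} p∤m p∤n p∣mn with euclidsLemma m n pr p∣mn
  ... | inj₁ p∣m = p∤m p∣m
  ... | inj₂ p∣n = p∤n p∣n

  p∣m*p^[1+j] : ∀ m j → p ∣ m * p ^ suc j
  p∣m*p^[1+j] m j = divides (m * p ^ j) (swap m (p ^ j) p)
    where
    swap : ∀ m q p → m * (p * q) ≡ m * q * p
    swap = ℕSolver.solve-∀

  unit-decomposition-fuel : ∀ f n → n ≤ f → 1 ≤ n →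
                            n ≡ uf f p n * p ^ νf f p n × p ∤ uf f p n
  unit-decomposition-fuel (suc f) (suc m) (s≤s m≤f) _ with p ∣? suc m
  ... | yes (divides zero ())
  ... | yes (divides q@(suc _) 1+m≡q*p) = decomposition , proj₂ q-decomposition
    where
    q<1+m : q < suc m
    q<1+m = subst (q <_) (sym 1+m≡q*p) (m<m*n q p 1<p)
    q-decomposition : q ≡ uf f p q * p ^ νf f p q × p ∤ uf f p q
    q-decomposition = unit-decomposition-fuel f q (≤-trans (≤-pred q<1+m) m≤f) (s≤s z≤n)
    decomposition : suc m ≡ uf f p q * p ^ suc (νf f p q)
    decomposition = begin
      suc m                               ≡⟨ 1+m≡q*p ⟩
      q * p                               ≡⟨ cong (_* p) (proj₁ q-decomposition) ⟩
      uf f p q * p ^ νf f p q * p         ≡⟨ swap (uf f p q) (p ^ νf f p q) p ⟩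
      uf f p q * (p * p ^ νf f p q)       ∎
      where
      open ≡-Reasoning
      swap : ∀ x y z → x * y * z ≡ x * (z * y)
      swap = ℕSolver.solve-∀
  ... | no p∤1+m = sym (*-identityʳ (suc m)) , p∤1+m

  n≡u*p^ν : ∀ {n} → 1 ≤ n → n ≡ u p n * p ^ ν p n
  n≡u*p^ν {n} 1≤n = proj₁ (unit-decomposition-fuel n n ≤-refl 1≤n)

  p∤u : ∀ {n} → 1 ≤ n → p ∤ u p n
  p∤u {n} 1≤n = proj₂ (unit-decomposition-fuel n n ≤-refl 1≤n)

  unit-unique : ∀ {m m'} i j → p ∤ m → p ∤ m' → m * p ^ i ≡ m' * p ^ j → m ≡ m'
  unit-unique {m} {m'} zero zero _ _ eq = begin
    m          ≡⟨ *-identityʳ m ⟨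
    m * 1      ≡⟨ eq ⟩
    m' * 1     ≡⟨ *-identityʳ m' ⟩
    m'         ∎
    where open ≡-Reasoning
  unit-unique {m} {m'} zero (suc j) p∤m _ eq =
    contradiction (subst (p ∣_) (trans (sym eq) (*-identityʳ m)) (p∣m*p^[1+j] m' j)) p∤m
  unit-unique {m} {m'} (suc i) zero _ p∤m' eq =
    contradiction (subst (p ∣_) (trans eq (*-identityʳ m')) (p∣m*p^[1+j] m i)) p∤m'
  unit-unique {m} {m'} (suc i) (suc j) p∤m p∤m' eq =
    unit-unique i j p∤m p∤m' (*-cancelˡ-≡ _ _ p (begin
      p * (m * p ^ i)      ≡⟨ x*[y*z]≡y*[x*z] m p (p ^ i) ⟨
      m * (p * p ^ i)      ≡⟨ eq ⟩
      m' * (p * p ^ j)     ≡⟨ x*[y*z]≡y*[x*z] m' p (p ^ j) ⟩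
      p * (m' * p ^ j)     ∎))
    where
    open ≡-Reasoning
    x*[y*z]≡y*[x*z] : ∀ x y z → x * (y * z) ≡ y * (x * z)
    x*[y*z]≡y*[x*z] = ℕSolver.solve-∀

  u[m*p^j]≡m : ∀ {m} j → p ∤ m → u p (m * p ^ j) ≡ m
  u[m*p^j]≡m {m} j p∤m = unit-unique (ν p (m * p ^ j)) j (p∤u 1≤m*p^j) p∤m (sym (n≡u*p^ν 1≤m*p^j))
    where
    1≤m*p^j : 1 ≤ m * p ^ j
    1≤m*p^j = *-mono-≤ (p∤m⇒1≤m p∤m) (m^n>0 p j)

  u[m]≡m : ∀ {m} → p ∤ m → u p m ≡ m
  u[m]≡m {m} p∤m = trans (cong (u p) (sym (*-identityʳ m))) (u[m*p^j]≡m 0 p∤m)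

  u[p^n]≡1 : ∀ n → u p (p ^ n) ≡ 1
  u[p^n]≡1 n = trans (cong (u p) (sym (*-identityˡ (p ^ n)))) (u[m*p^j]≡m n p∤1)

  u-* : ∀ {m n} → 1 ≤ m → 1 ≤ n → u p (m * n) ≡ u p m * u p n
  u-* {m} {n} 1≤m 1≤n = begin
    u p (m * n)
      ≡⟨ cong (u p) (cong₂ _*_ (n≡u*p^ν 1≤m) (n≡u*p^ν 1≤n)) ⟩
    u p (u p m * p ^ ν p m * (u p n * p ^ ν p n))
      ≡⟨ cong (u p) (regroup (u p m) (u p n) (p ^ ν p m) (p ^ ν p n)) ⟩
    u p (u p m * u p n * (p ^ ν p m * p ^ ν p n))
      ≡⟨ cong (λ k → u p (u p m * u p n * k)) (^-distribˡ-+-* p (ν p m) (ν p n)) ⟨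
    u p (u p m * u p n * p ^ (ν p m + ν p n))
      ≡⟨ u[m*p^j]≡m (ν p m + ν p n) (p∤m⇒p∤n⇒p∤m*n (p∤u 1≤m) (p∤u 1≤n)) ⟩
    u p m * u p n ∎
    where
    open ≡-Reasoning
    regroup : ∀ x y z w → x * z * (y * w) ≡ x * y * (z * w)
    regroup = ℕSolver.solve-∀

  u[n]*p^[E+ν[n]]≡n*p^E : ∀ {n} E → 1 ≤ n → u p n * p ^ (E + ν p n) ≡ n * p ^ E
  u[n]*p^[E+ν[n]]≡n*p^E {n} E 1≤n = begin
    u p n * p ^ (E + ν p n)          ≡⟨ cong (u p n *_) (^-distribˡ-+-* p E (ν p n)) ⟩
    u p n * (p ^ E * p ^ ν p n)      ≡⟨ regroup (u p n) (p ^ E) (p ^ ν p n) ⟩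
    u p n * p ^ ν p n * p ^ E        ≡⟨ cong (_* p ^ E) (n≡u*p^ν 1≤n) ⟨
    n * p ^ E                        ∎
    where
    open ≡-Reasoning
    regroup : ∀ x y z → x * (y * z) ≡ x * z * y
    regroup = ℕSolver.solve-∀

  -1^[p*u[n]*x]≡-1^[p*n*x] : ∀ {n} x → 1 ≤ n → -1^ (p * u p n * x) ≡ -1^ (p * n * x)
  -1^[p*u[n]*x]≡-1^[p*n*x] {n} x 1≤n = begin
    -1^ (p * u p n * x)                  ≡⟨ -1^[m*[k*m^j]*x]≡-1^[m*k*x] p (u p n) (ν p n) x ⟨
    -1^ (p * (u p n * p ^ ν p n) * x)    ≡⟨ cong (λ m → -1^ (p * m * x)) (n≡u*p^ν 1≤n) ⟨
    -1^ (p * n * x)                      ∎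
    where open ≡-Reasoning

  coprimeFactorial : ℕ → ℕ
  coprimeFactorial zero = 1
  coprimeFactorial (suc n) with p ∣? suc n
  ... | yes _ = coprimeFactorial n
  ... | no  _ = coprimeFactorial n * suc n

  multiplesFactorial : ℕ → ℕ
  multiplesFactorial zero = 1
  multiplesFactorial (suc n) with p ∣? suc n
  ... | yes _ = multiplesFactorial n * suc n
  ... | no  _ = multiplesFactorial n

  coprimeFactorial-∣ : ∀ {n} → p ∣ suc n → coprimeFactorial (suc n) ≡ coprimeFactorial n
  coprimeFactorial-∣ {n} p∣1+n with p ∣? suc n
  ... | yes _    = refl
  ... | no p∤1+n = contradiction p∣1+n p∤1+n

  coprimeFactorial-∤ : ∀ {n} → p ∤ suc n → coprimeFactorial (suc n) ≡ coprimeFactorial n * suc n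
  coprimeFactorial-∤ {n} p∤1+n with p ∣? suc n
  ... | yes p∣1+n = contradiction p∣1+n p∤1+n
  ... | no _      = refl

  multiplesFactorial-∣ : ∀ {n} → p ∣ suc n → multiplesFactorial (suc n) ≡ multiplesFactorial n * suc n
  multiplesFactorial-∣ {n} p∣1+n with p ∣? suc n
  ... | yes _    = refl
  ... | no p∤1+n = contradiction p∣1+n p∤1+n

  multiplesFactorial-∤ : ∀ {n} → p ∤ suc n → multiplesFactorial (suc n) ≡ multiplesFactorial n
  multiplesFactorial-∤ {n} p∤1+n with p ∣? suc n
  ... | yes p∣1+n = contradiction p∣1+n p∤1+n
  ... | no _      = refl

  p∤coprimeFactorial : ∀ n → p ∤ coprimeFactorial n
  p∤coprimeFactorial zero = p∤1
  p∤coprimeFactorial (suc n) with p ∣? suc n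
  ... | yes _    = p∤coprimeFactorial n
  ... | no p∤1+n = p∤m⇒p∤n⇒p∤m*n (p∤coprimeFactorial n) p∤1+n

  n!≡coprimeFactorial*multiplesFactorial : ∀ n → n ! ≡ coprimeFactorial n * multiplesFactorial n
  n!≡coprimeFactorial*multiplesFactorial zero = refl
  n!≡coprimeFactorial*multiplesFactorial (suc n) with p ∣? suc n
  ... | yes _ = trans (cong (suc n *_) (n!≡coprimeFactorial*multiplesFactorial n))
                      (into-right (suc n) (coprimeFactorial n) (multiplesFactorial n))
    where
    into-right : ∀ x y z → x * (y * z) ≡ y * (z * x)
    into-right = ℕSolver.solve-∀
  ... | no _  = trans (cong (suc n *_) (n!≡coprimeFactorial*multiplesFactorial n))
                      (into-left (suc n) (coprimeFactorial n) (multiplesFactorial n))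
    where
    into-left : ∀ x y z → x * (y * z) ≡ y * x * z
    into-left = ℕSolver.solve-∀

  multiplesFactorial[n*p+r]≡multiplesFactorial[n*p] : ∀ n r → r < p →
    multiplesFactorial (n * p + r) ≡ multiplesFactorial (n * p)
  multiplesFactorial[n*p+r]≡multiplesFactorial[n*p] n zero _ = cong multiplesFactorial (+-identityʳ (n * p))
  multiplesFactorial[n*p+r]≡multiplesFactorial[n*p] n (suc r) 1+r<p = begin
    multiplesFactorial (n * p + suc r)   ≡⟨ cong multiplesFactorial (+-suc (n * p) r) ⟩
    multiplesFactorial (suc (n * p + r)) ≡⟨ multiplesFactorial-∤ p∤ ⟩
    multiplesFactorial (n * p + r)       ≡⟨ multiplesFactorial[n*p+r]≡multiplesFactorial[n*p] n r (<-trans (n<1+n r) 1+r<p) ⟩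
    multiplesFactorial (n * p)           ∎
    where
    open ≡-Reasoning
    p∤ : p ∤ suc (n * p + r)
    p∤ p∣ = <⇒≱ 1+r<p (∣⇒≤ (∣m+n∣m⇒∣n (subst (p ∣_) (sym (+-suc (n * p) r)) p∣) (n∣m*n n)))

  multiplesFactorial[n*p]≡p^n*n! : ∀ n → multiplesFactorial (n * p) ≡ p ^ n * n !
  multiplesFactorial[n*p]≡p^n*n! zero = refl
  multiplesFactorial[n*p]≡p^n*n! (suc n) = begin
    multiplesFactorial (suc n * p)                       ≡⟨ cong multiplesFactorial [1+n]*p≡1+[n*p+p∸1] ⟩
    multiplesFactorial (suc (n * p + pred p))            ≡⟨ multiplesFactorial-∣ (divides (suc n) (sym [1+n]*p≡1+[n*p+p∸1])) ⟩
    multiplesFactorial (n * p + pred p) * suc (n * p + pred p)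
      ≡⟨ cong₂ _*_ (multiplesFactorial[n*p+r]≡multiplesFactorial[n*p] n (pred p) pred[p]<p) (sym [1+n]*p≡1+[n*p+p∸1]) ⟩
    multiplesFactorial (n * p) * (suc n * p)             ≡⟨ cong (_* (suc n * p)) (multiplesFactorial[n*p]≡p^n*n! n) ⟩
    p ^ n * n ! * (suc n * p)                            ≡⟨ regroup (p ^ n) (n !) (suc n) p ⟩
    p * p ^ n * (suc n * n !)                            ∎
    where
    open ≡-Reasoning
    [1+n]*p≡1+[n*p+p∸1] : suc n * p ≡ suc (n * p + pred p)
    [1+n]*p≡1+[n*p+p∸1] = trans (cong (_+ n * p) (sym (suc-pred p))) (cong suc (+-comm (pred p) (n * p)))
    pred[p]<p : pred p < p
    pred[p]<p = subst (pred p <_) (suc-pred p) (n<1+n (pred p))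
    regroup : ∀ q f m p → q * f * (m * p) ≡ p * q * (m * f)
    regroup = ℕSolver.solve-∀

  u[[n*p]!]≡coprimeFactorial[n*p]*u[n!] : ∀ n → u p ((n * p) !) ≡ coprimeFactorial (n * p) * u p (n !)
  u[[n*p]!]≡coprimeFactorial[n*p]*u[n!] n = begin
    u p ((n * p) !)
      ≡⟨ cong (u p) (n!≡coprimeFactorial*multiplesFactorial (n * p)) ⟩
    u p (coprimeFactorial (n * p) * multiplesFactorial (n * p))
      ≡⟨ cong (λ m → u p (coprimeFactorial (n * p) * m)) (multiplesFactorial[n*p]≡p^n*n! n) ⟩
    u p (coprimeFactorial (n * p) * (p ^ n * n !))
      ≡⟨ u-* (p∤m⇒1≤m (p∤coprimeFactorial (n * p))) (*-mono-≤ (m^n>0 p n) (1≤n! n)) ⟩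
    u p (coprimeFactorial (n * p)) * u p (p ^ n * n !)
      ≡⟨ cong₂ _*_ (u[m]≡m (p∤coprimeFactorial (n * p))) (u-* (m^n>0 p n) (1≤n! n)) ⟩
    coprimeFactorial (n * p) * (u p (p ^ n) * u p (n !))
      ≡⟨ cong (λ m → coprimeFactorial (n * p) * (m * u p (n !))) (u[p^n]≡1 n) ⟩
    coprimeFactorial (n * p) * (1 * u p (n !))
      ≡⟨ cong (coprimeFactorial (n * p) *_) (*-identityˡ (u p (n !))) ⟩
    coprimeFactorial (n * p) * u p (n !) ∎
    where open ≡-Reasoning

  u-binomial : ∀ {n k} → k ≤ n → u p (n C k) * u p (k !) * u p ((n ∸ k) !) ≡ u p (n !)
  u-binomial {n} {k} k≤n = begin
    u p (n C k) * u p (k !) * u p ((n ∸ k) !)     ≡⟨ *-assoc (u p (n C k)) _ _ ⟩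
    u p (n C k) * (u p (k !) * u p ((n ∸ k) !))   ≡⟨ cong (u p (n C k) *_) (u-* (1≤n! k) (1≤n! (n ∸ k))) ⟨
    u p (n C k) * u p (k ! * (n ∸ k) !)           ≡⟨ u-* 1≤nCk (*-mono-≤ (1≤n! k) (1≤n! (n ∸ k))) ⟨
    u p ((n C k) * (k ! * (n ∸ k) !))               ≡⟨ cong (u p) nCk*k!*[n∸k]!≡n! ⟩
    u p (n !)                                     ∎
    where
    open ≡-Reasoning
    nCk*k!*[n∸k]!≡n! : (n C k) * (k ! * (n ∸ k) !) ≡ n !
    nCk*k!*[n∸k]!≡n! = trans (cong (_* (k ! * (n ∸ k) !)) (nCk≡n!/k![n-k]! k≤n))
                              (m/n*n≡m {{_!*_!≢0 k (n ∸ k)}} (k![n∸k]!∣n! k≤n))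
    1≤nCk : 1 ≤ n C k
    1≤nCk with n C k | nCk*k!*[n∸k]!≡n!
    ... | zero  | 0≡n! = contradiction 0≡n! (<⇒≢ (1≤n! n))
    ... | suc _ | _    = s≤s z≤n

module Congruence (P : ℕ) where

  infix 4 _≈_ _≋_

  record _≈_ (x y : ℤ) : Set where
    constructor congruent
    field ∣-difference : + P ℤDS.∣ x ℤ.- y
  open _≈_ public

  ≈-refl : ∀ {x} → x ≈ x
  ≈-refl {x} = congruent (subst (+ P ℤDS.∣_) (sym (ℤP.+-inverseʳ x)) (ℤDS.divides (+ 0) refl))

  ≈-sym : ∀ {x y} → x ≈ y → y ≈ x
  ≈-sym {x} {y} (congruent P∣x-y) = congruent (subst (+ P ℤDS.∣_) (negate y x) (ℤDS.∣m⇒∣-m P∣x-y))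
    where
    negate : ∀ y x → ℤ.- (x ℤ.- y) ≡ y ℤ.- x
    negate = solve-∀

  ≈-trans : ∀ {x y z} → x ≈ y → y ≈ z → x ≈ z
  ≈-trans {x} {y} {z} (congruent P∣x-y) (congruent P∣y-z) =
    congruent (subst (+ P ℤDS.∣_) (telescope x y z) (ℤDS.∣m∣n⇒∣m+n P∣x-y P∣y-z))
    where
    telescope : ∀ x y z → (x ℤ.- y) ℤ.+ (y ℤ.- z) ≡ x ℤ.- z
    telescope = solve-∀

  ≈-*-cong : ∀ {x x' y y'} → x ≈ x' → y ≈ y' → x ℤ.* y ≈ x' ℤ.* y'
  ≈-*-cong {x} {x'} {y} {y'} (congruent P∣x-x') (congruent P∣y-y') =
    congruent (subst (+ P ℤDS.∣_) (product-difference x x' y y')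
      (ℤDS.∣m∣n⇒∣m+n (ℤDS.∣n⇒∣m*n x P∣y-y') (ℤDS.∣m⇒∣m*n y' P∣x-x')))
    where
    product-difference : ∀ x x' y y' → x ℤ.* (y ℤ.- y') ℤ.+ (x ℤ.- x') ℤ.* y' ≡ x ℤ.* y ℤ.- x' ℤ.* y'
    product-difference = solve-∀

  ≈-isEquivalence : IsEquivalence _≈_
  ≈-isEquivalence = record { refl = ≈-refl ; sym = ≈-sym ; trans = ≈-trans }

  ≈-setoid : Setoid 0ℓ 0ℓ
  ≈-setoid = record { isEquivalence = ≈-isEquivalence }

  _≋_ : ℕ → ℕ → Set
  m ≋ n = + m ≈ + n

  ≋-setoid : Setoid 0ℓ 0ℓ
  ≋-setoid = On.setoid ≈-setoid (λ n → + n)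

  ≋-*-cong : ∀ {m m' n n'} → m ≋ m' → n ≋ n' → m * n ≋ m' * n'
  ≋-*-cong {m} {m'} {n} {n'} m≋m' n≋n' =
    subst₂ _≈_ (sym (ℤP.pos-* m n)) (sym (ℤP.pos-* m' n')) (≈-*-cong m≋m' n≋n')

  P∣m⇒m+n≋n : ∀ {m} n → P ∣ m → m + n ≋ n
  P∣m⇒m+n≋n {m} n (divides q m≡q*P) = congruent (ℤDS.divides (+ q) (begin
    + (m + n) ℤ.- + n     ≡⟨ cong (ℤ._- + n) (ℤP.pos-+ m n) ⟩
    + m ℤ.+ + n ℤ.- + n   ≡⟨ cancel (+ m) (+ n) ⟩
    + m                   ≡⟨ cong +_ m≡q*P ⟩
    + (q * P)             ≡⟨ ℤP.pos-* q P ⟩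
    + q ℤ.* + P           ∎))
    where
    open ≡-Reasoning
    cancel : ∀ x y → x ℤ.+ y ℤ.- y ≡ x
    cancel = solve-∀

module ModPrimePower {p : ℕ} (pr : Prime p) (e : ℕ) (1≤e : 1 ≤ e) where

  open UnitPart pr
  open Congruence (p ^ e)
  open ℕP

  private
    P : ℕ
    P = p ^ e

    p∣P : p ∣ P
    p∣P = subst (λ n → p ∣ p ^ n) (suc-pred e {{ℕ.>-nonZero 1≤e}}) (m∣m*n (p ^ pred e))

  coprimeFactorial-periodic : ∀ {N} t → P ∣ N →
    coprimeFactorial (N + t) ≋ coprimeFactorial N * coprimeFactorial t
  coprimeFactorial-periodic {N} zero _ = begin
    coprimeFactorial (N + 0)       ≡⟨ cong coprimeFactorial (+-identityʳ N) ⟩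
    coprimeFactorial N             ≡⟨ *-identityʳ (coprimeFactorial N) ⟨
    coprimeFactorial N * 1         ∎
    where open import Relation.Binary.Reasoning.Setoid ≋-setoid
  coprimeFactorial-periodic {N} (suc t) P∣N with p ∣? suc t
  ... | yes p∣1+t = begin
    coprimeFactorial (N + suc t)            ≡⟨ cong coprimeFactorial (+-suc N t) ⟩
    coprimeFactorial (suc (N + t))          ≡⟨ coprimeFactorial-∣ p∣1+N+t ⟩
    coprimeFactorial (N + t)                ≈⟨ coprimeFactorial-periodic t P∣N ⟩
    coprimeFactorial N * coprimeFactorial t ∎
    where
    open import Relation.Binary.Reasoning.Setoid ≋-setoid
    p∣1+N+t : p ∣ suc (N + t)
    p∣1+N+t = subst (p ∣_) (+-suc N t) (∣m∣n⇒∣m+n (∣-trans p∣P P∣N) p∣1+t)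
  ... | no p∤1+t = begin
    coprimeFactorial (N + suc t)                      ≡⟨ cong coprimeFactorial (+-suc N t) ⟩
    coprimeFactorial (suc (N + t))                    ≡⟨ coprimeFactorial-∤ p∤1+N+t ⟩
    coprimeFactorial (N + t) * suc (N + t)            ≈⟨ ≋-*-cong (coprimeFactorial-periodic t P∣N) 1+N+t≋1+t ⟩
    coprimeFactorial N * coprimeFactorial t * suc t   ≡⟨ *-assoc (coprimeFactorial N) _ _ ⟩
    coprimeFactorial N * (coprimeFactorial t * suc t) ∎
    where
    open import Relation.Binary.Reasoning.Setoid ≋-setoid
    p∤1+N+t : p ∤ suc (N + t)
    p∤1+N+t p∣ = p∤1+t (∣m+n∣m⇒∣n (subst (p ∣_) (sym (+-suc N t)) p∣) (∣-trans p∣P P∣N))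
    1+N+t≋1+t : suc (N + t) ≋ suc t
    1+N+t≋1+t = subst (_≋ suc t) (+-suc N t) (P∣m⇒m+n≋n (suc t) P∣N)

  coprimeFactorial[q*P]≋coprimeFactorial[P]^q : ∀ q → coprimeFactorial (q * P) ≋ coprimeFactorial P ^ q
  coprimeFactorial[q*P]≋coprimeFactorial[P]^q zero = ≈-refl
  coprimeFactorial[q*P]≋coprimeFactorial[P]^q (suc q) = begin
    coprimeFactorial (P + q * P)               ≡⟨ cong coprimeFactorial (+-comm P (q * P)) ⟩
    coprimeFactorial (q * P + P)               ≈⟨ coprimeFactorial-periodic P (n∣m*n q) ⟩
    coprimeFactorial (q * P) * coprimeFactorial P
      ≈⟨ ≋-*-cong (coprimeFactorial[q*P]≋coprimeFactorial[P]^q q) ≈-refl ⟩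
    coprimeFactorial P ^ q * coprimeFactorial P ≡⟨ *-comm (coprimeFactorial P ^ q) _ ⟩
    coprimeFactorial P * coprimeFactorial P ^ q ∎
    where open import Relation.Binary.Reasoning.Setoid ≋-setoid

  unitFactorial-lift : ∀ d → ∃[ s ] ∀ M →
    u p ((M * p ^ (e + d)) !) ≋ u p ((M * P) !) * coprimeFactorial P ^ (M * s)
  unitFactorial-lift zero = 0 , λ M → begin
    u p ((M * p ^ (e + 0)) !)                    ≡⟨ cong (λ n → u p ((M * p ^ n) !)) (+-identityʳ e) ⟩
    u p ((M * P) !)                              ≡⟨ *-identityʳ _ ⟨
    u p ((M * P) !) * 1                          ≡⟨ cong (λ n → u p ((M * P) !) * coprimeFactorial P ^ n) (*-zeroʳ M) ⟨
    u p ((M * P) !) * coprimeFactorial P ^ (M * 0) ∎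
    where open import Relation.Binary.Reasoning.Setoid ≋-setoid
  unitFactorial-lift (suc d) with unitFactorial-lift d
  ... | s , lift = s + p ^ suc d , lift′
    where
    W : ℕ
    W = coprimeFactorial P
    lift′ : ∀ M → u p ((M * p ^ (e + suc d)) !) ≋ u p ((M * P) !) * W ^ (M * (s + p ^ suc d))
    lift′ M = begin
      u p ((M * p ^ (e + suc d)) !)
        ≡⟨ cong (λ n → u p (n !)) M*p^[e+1+d]≡M*p^[e+d]*p ⟩
      u p ((M * p ^ (e + d) * p) !)
        ≡⟨ u[[n*p]!]≡coprimeFactorial[n*p]*u[n!] (M * p ^ (e + d)) ⟩
      coprimeFactorial (M * p ^ (e + d) * p) * u p ((M * p ^ (e + d)) !)
        ≡⟨ cong (λ n → coprimeFactorial n * u p ((M * p ^ (e + d)) !)) M*p^[e+d]*p≡M*p^[1+d]*P ⟩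
      coprimeFactorial (M * p ^ suc d * P) * u p ((M * p ^ (e + d)) !)
        ≈⟨ ≋-*-cong (coprimeFactorial[q*P]≋coprimeFactorial[P]^q (M * p ^ suc d)) (lift M) ⟩
      W ^ (M * p ^ suc d) * (u p ((M * P) !) * W ^ (M * s))
        ≡⟨ rotate (W ^ (M * p ^ suc d)) (u p ((M * P) !)) (W ^ (M * s)) ⟩
      u p ((M * P) !) * (W ^ (M * s) * W ^ (M * p ^ suc d))
        ≡⟨ cong (u p ((M * P) !) *_) (^-distribˡ-+-* W (M * s) (M * p ^ suc d)) ⟨
      u p ((M * P) !) * W ^ (M * s + M * p ^ suc d)
        ≡⟨ cong (λ n → u p ((M * P) !) * W ^ n) (*-distribˡ-+ M s (p ^ suc d)) ⟨
      u p ((M * P) !) * W ^ (M * (s + p ^ suc d)) ∎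
      where
      open import Relation.Binary.Reasoning.Setoid ≋-setoid
      M*p^[e+1+d]≡M*p^[e+d]*p : M * p ^ (e + suc d) ≡ M * p ^ (e + d) * p
      M*p^[e+1+d]≡M*p^[e+d]*p = trans (cong (λ n → M * p ^ n) (+-suc e d)) (move M (p ^ (e + d)) p)
        where
        move : ∀ m q p → m * (p * q) ≡ m * q * p
        move = ℕSolver.solve-∀
      M*p^[e+d]*p≡M*p^[1+d]*P : M * p ^ (e + d) * p ≡ M * p ^ suc d * P
      M*p^[e+d]*p≡M*p^[1+d]*P = trans (cong (λ n → M * n * p) (^-distribˡ-+-* p e d)) (move M P (p ^ d) p)
        where
        move : ∀ m P q p → m * (P * q) * p ≡ m * (p * q) * P
        move = ℕSolver.solve-∀
      rotate : ∀ x y z → x * (y * z) ≡ y * (z * x)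
      rotate = ℕSolver.solve-∀

  binomial-unit-lift : ∀ {a b} d → b ≤ a →
    u p ((a * P) C (b * P)) * u p ((b * p ^ (e + d)) !) * u p (((a ∸ b) * p ^ (e + d)) !)
      ≋ u p ((a * p ^ (e + d)) !)
  binomial-unit-lift {a} {b} d b≤a with unitFactorial-lift d
  ... | s , lift = begin
    uC * u p ((b * p ^ (e + d)) !) * u p (((a ∸ b) * p ^ (e + d)) !)
      ≈⟨ ≋-*-cong (≋-*-cong (≈-refl {+ uC}) (lift b)) (lift (a ∸ b)) ⟩
    uC * (U b * W ^ (b * s)) * (U (a ∸ b) * W ^ ((a ∸ b) * s))
      ≡⟨ regroup uC (U b) (U (a ∸ b)) (W ^ (b * s)) (W ^ ((a ∸ b) * s)) ⟩
    uC * U b * U (a ∸ b) * (W ^ (b * s) * W ^ ((a ∸ b) * s))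
      ≡⟨ cong₂ _*_ units powers ⟩
    U a * W ^ (a * s)
      ≈⟨ lift a ⟨
    u p ((a * p ^ (e + d)) !) ∎
    where
    open import Relation.Binary.Reasoning.Setoid ≋-setoid
    uC W : ℕ
    uC = u p ((a * P) C (b * P))
    W = coprimeFactorial P
    U : ℕ → ℕ
    U n = u p ((n * P) !)
    units : uC * U b * U (a ∸ b) ≡ U a
    units = trans (cong (λ n → uC * U b * u p (n !)) (*-distribʳ-∸ P a b)) (u-binomial (*-monoˡ-≤ P b≤a))
    powers : W ^ (b * s) * W ^ ((a ∸ b) * s) ≡ W ^ (a * s)
    powers = trans (sym (^-distribˡ-+-* W (b * s) ((a ∸ b) * s)))
                   (cong (W ^_) (trans (sym (*-distribʳ-+ s b (a ∸ b))) (cong (_* s) (m+[n∸m]≡n b≤a))))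
    regroup : ∀ c x y v w → c * (x * v) * (y * w) ≡ c * x * y * (v * w)
    regroup = ℕSolver.solve-∀

  z-approx : ∀ n z (lim : IsZ p n z) → 1 ≤ n → ∀ E → proj₁ (lim e) ≤ E →
             seq z e ≈ -1^ (p * n * (E + ν p n)) ℤ.* + u p ((n * p ^ E) !)
  z-approx n z lim 1≤n E E₀≤E = begin
    seq z e
      ≈⟨ congruent (ℤDS.∣ᵤ⇒∣ (proj₂ (lim e) (E + ν p n) (≤-trans E₀≤E (m≤m+n E (ν p n))))) ⟨
    zseq p (u p n) (E + ν p n)
      ≡⟨ cong₂ (λ σ m → σ ℤ.* + u p (m !)) (-1^[p*u[n]*x]≡-1^[p*n*x] (E + ν p n) 1≤n)
                                           (u[n]*p^[E+ν[n]]≡n*p^E E 1≤n) ⟩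
    -1^ (p * n * (E + ν p n)) ℤ.* + u p ((n * p ^ E) !) ∎
    where open import Relation.Binary.Reasoning.Setoid ≈-setoid

theorem1p3 : (p : ℕ) → Prime p → (a b k c : ℕ) → 1 ≤ b → b < a →
    ν p (a ∸ b) ≡ 0 →
    ((ν p a ≡ 0 × ν p b ≡ k) ⊎ (ν p a ≡ k × ν p b ≡ 0)) →
    ((ν p a ≡ k × c ≡ a) ⊎ (ν p b ≡ k × c ≡ b)) →
    (za zb zab : ℤp p) → IsZ p a za → IsZ p b zb → IsZ p (a ∸ b) zab →
    (e : ℕ) → 1 ≤ e →
    (+ (p ^ e)) ℤD.∣
      ((+ u p (((a * p ^ e) C (b * p ^ e)))) ℤ.* seq zb e ℤ.* seq zab e
        ℤ.- ((- (+ 1)) ℤ.^ (p * c * k)) ℤ.* seq za e)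
theorem1p3 p pr a b k c 1≤b b<a ν[a∸b]≡0 valuations choice za zb zab za-lim zb-lim zab-lim e 1≤e =
  ℤDS.∣⇒∣ᵤ (∣-difference (begin
    + uC ℤ.* seq zb e ℤ.* seq zab e
      ≈⟨ ≈-*-cong (≈-*-cong (≈-refl {+ uC}) (z-approx b zb zb-lim 1≤b E Eb≤E)) (z-approx (a ∸ b) zab zab-lim 1≤a∸b E Eab≤E) ⟩
    + uC ℤ.* (σ b ℤ.* + U b) ℤ.* (σ (a ∸ b) ℤ.* + U (a ∸ b))
      ≡⟨ regroup (+ uC) (σ b) (σ (a ∸ b)) (+ U b) (+ U (a ∸ b)) ⟩
    σ b ℤ.* σ (a ∸ b) ℤ.* (+ uC ℤ.* + U b ℤ.* + U (a ∸ b))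
      ≡⟨ cong (σ b ℤ.* σ (a ∸ b) ℤ.*_) (+[x*y*z] uC (U b) (U (a ∸ b))) ⟨
    σ b ℤ.* σ (a ∸ b) ℤ.* + (uC * U b * U (a ∸ b))
      ≈⟨ ≈-*-cong (≈-refl {σ b ℤ.* σ (a ∸ b)}) (binomial-unit-lift d b≤a) ⟩
    σ b ℤ.* σ (a ∸ b) ℤ.* + U a
      ≡⟨ cong (ℤ._* + U a) (-1^-balance p E b≤a ν[a∸b]≡0 valuations choice) ⟩
    -1^ (p * c * k) ℤ.* σ a ℤ.* + U a
      ≡⟨ ℤP.*-assoc (-1^ (p * c * k)) (σ a) (+ U a) ⟩
    -1^ (p * c * k) ℤ.* (σ a ℤ.* + U a)
      ≈⟨ ≈-*-cong (≈-refl { -1^ (p * c * k)}) (z-approx a za za-lim 1≤a E Ea≤E) ⟨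
    -1^ (p * c * k) ℤ.* seq za e ∎))
  where
  open ModPrimePower pr e 1≤e
  open Congruence (p ^ e)
  open import Relation.Binary.Reasoning.Setoid ≈-setoid
  Ea Eb Eab d E : ℕ
  Ea = proj₁ (za-lim e)
  Eb = proj₁ (zb-lim e)
  Eab = proj₁ (zab-lim e)
  d = Ea ⊔ Eb ⊔ Eab
  E = e + d
  Ea≤E : Ea ≤ E
  Ea≤E = ℕP.m≤n⇒m≤o+n e (ℕP.≤-trans (ℕP.m≤m⊔n Ea Eb) (ℕP.m≤m⊔n _ Eab))
  Eb≤E : Eb ≤ E
  Eb≤E = ℕP.m≤n⇒m≤o+n e (ℕP.≤-trans (ℕP.m≤n⊔m Ea Eb) (ℕP.m≤m⊔n _ Eab))
  Eab≤E : Eab ≤ E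
  Eab≤E = ℕP.m≤n⇒m≤o+n e (ℕP.m≤n⊔m (Ea ⊔ Eb) Eab)
  b≤a : b ≤ a
  b≤a = ℕP.<⇒≤ b<a
  1≤a : 1 ≤ a
  1≤a = ℕP.≤-trans 1≤b b≤a
  1≤a∸b : 1 ≤ a ∸ b
  1≤a∸b = ℕP.m<n⇒0<n∸m b<a
  uC : ℕ
  uC = u p ((a * p ^ e) C (b * p ^ e))
  σ : ℕ → ℤ
  σ n = -1^ (p * n * (E + ν p n))
  U : ℕ → ℕ
  U n = u p ((n * p ^ E) !)
  regroup : ∀ c x y v w → c ℤ.* (x ℤ.* v) ℤ.* (y ℤ.* w) ≡ x ℤ.* y ℤ.* (c ℤ.* v ℤ.* w)
  regroup = solve-∀
  +[x*y*z] : ∀ x y z → + (x * y * z) ≡ + x ℤ.* + y ℤ.* + z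
  +[x*y*z] x y z = trans (ℤP.pos-* (x * y) z) (cong (ℤ._* + z) (ℤP.pos-* x y))
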